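{- Let $a,b$ be relatively prime positive integers, $n\ge1$, and let $\pi$ be an $(a,b)$-Dyck path of size $n$. For an $(a,b)$-Dyck path $\sigma$ of size $n$, let $(r_{i,j}(\sigma))_{i\in[1,b],j\in[1,a]}$ be its Dyck path decomposition. Then $$\#\{\pi'\in\mathfrak{D}^{(a,b)}_n:\ r_{i,j}(\pi)\le r_{i,j}(\pi')\ \text{for all } i\in[1,b],\ j\in[1,a]\}=\#\{\pi'\in\mathfrak{D}^{(a,b)}_n:\ \pi\le\pi'\}.$$
   Context: $\mathfrak{D}^{(a,b)}_n$ is the set of $(a,b)$-Dyck paths of size $n$: lattice paths from $(0,0)$ to $(bn,an)$ with unit steps $N=(0,1)$, $E=(1,0)$ never going below $y=ax/b$. For two lattice paths with the same endpoints, $\sigma\le\sigma'$ means $\sigma'$ is weakly above $\sigma$, i.e. the Young diagram bounded by $\sigma'$, the line $x=0$ and the top horizontal line through the endpoint is contained in that of $\sigma$. Step sequence: $u_k$ is the $x$-coordinate of the $k$-th north step; height sequence: $h_k$ is the $y$-coordinate of the $k$-th east step. Dyck path decomposition: if $\sigma$ has height sequence $(h_1,\dots,h_{bn})$, let $p_i$ ($i\in[1,b]$) be the path from $(0,0)$ to $(n,an)$ with height sequence $(h_{(k-1)b+i})_{k=1}^n$; if $p_i$ has step sequence $(u_1,\dots,u_{an})$, let $r_{i,j}(\sigma)$ ($j\in[1,a]$) be the path from $(0,0)$ to $(n,n)$ with step sequence $(u_{(k-1)a+j})_{k=1}^n$. -}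

module Defs where

open import Data.Nat using (ℕ; zero; suc; _+_; _*_; _∸_; _≤_; _≥_)
open import Data.Nat.Properties using (_≤?_)
open import Data.List using (List; []; _∷_; _++_; map; replicate; length; filter)
open import Data.List.Relation.Unary.All using (All; all?)
open import Data.List.Relation.Binary.Pointwise using (Pointwise)
import Data.List.Relation.Binary.Pointwise as PW
open import Data.Product using (_×_; _,_)
open import Data.Product.Relation.Binary.Pointwise.NonDependent using ()
open import Relation.Nullary using (Dec)
open import Relation.Nullary.Decidable using (_×-dec_)
open import Relation.Binary.PropositionalEquality using (_≡_)
import Data.Nat as ℕ
open import Data.Fin using (Fin; toℕ)
import Data.Fin.Properties as FP

-- unit steps: N = (0,1), E = (1,0)
data Step : Set where
  N E : Step

#E : List Step → ℕ
#E [] = 0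
#E (E ∷ p) = suc (#E p)
#E (N ∷ p) = #E p

#N : List Step → ℕ
#N [] = 0
#N (N ∷ p) = suc (#N p)
#N (E ∷ p) = #N p

pointsFrom : ℕ → ℕ → List Step → List (ℕ × ℕ)
pointsFrom x y [] = (x , y) ∷ []
pointsFrom x y (N ∷ p) = (x , y) ∷ pointsFrom x (suc y) p
pointsFrom x y (E ∷ p) = (x , y) ∷ pointsFrom (suc x) y p

points : List Step → List (ℕ × ℕ)
points = pointsFrom 0 0

WeaklyAbove : ℕ → ℕ → ℕ × ℕ → Set
WeaklyAbove a b (x , y) = a * x ≤ b * y

IsDyck : ℕ → ℕ → ℕ → List Step → Set
IsDyck a b n σ = (#E σ ≡ b * n) × (#N σ ≡ a * n) × All (WeaklyAbove a b) (points σ)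

isDyck? : ∀ a b n σ → Dec (IsDyck a b n σ)
isDyck? a b n σ =
  (#E σ ℕ.≟ b * n) ×-dec ((#N σ ℕ.≟ a * n) ×-dec all? (λ { (x , y) → a * x ≤? b * y }) (points σ))

words : ℕ → ℕ → List (List Step)
words zero zero = [] ∷ []
words zero (suc m) = map (N ∷_) (words zero m)
words (suc e) zero = map (E ∷_) (words e zero)
words (suc e) (suc m) = map (E ∷_) (words e (suc m)) ++ map (N ∷_) (words (suc e) m)

dyckPaths : ℕ → ℕ → ℕ → List (List Step)
dyckPaths a b n = filter (isDyck? a b n) (words (b * n) (a * n))

stepSeqFrom : ℕ → List Step → List ℕ
stepSeqFrom x [] = []
stepSeqFrom x (N ∷ p) = x ∷ stepSeqFrom x p
stepSeqFrom x (E ∷ p) = stepSeqFrom (suc x) p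

stepSeq : List Step → List ℕ
stepSeq = stepSeqFrom 0

heightSeqFrom : ℕ → List Step → List ℕ
heightSeqFrom y [] = []
heightSeqFrom y (E ∷ p) = y ∷ heightSeqFrom y p
heightSeqFrom y (N ∷ p) = heightSeqFrom (suc y) p

heightSeq : List Step → List ℕ
heightSeq = heightSeqFrom 0

-- path ending at height `top` with given (weakly increasing) height sequence
fromHeightsFrom : ℕ → ℕ → List ℕ → List Step
fromHeightsFrom top cur [] = replicate (top ∸ cur) N
fromHeightsFrom top cur (h ∷ hs) = replicate (h ∸ cur) N ++ (E ∷ fromHeightsFrom top h hs)

fromHeights : ℕ → List ℕ → List Step
fromHeights top = fromHeightsFrom top 0

-- path ending at x-coordinate `right` with given (weakly increasing) step sequence
fromStepsFrom : ℕ → ℕ → List ℕ → List Step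
fromStepsFrom right cur [] = replicate (right ∸ cur) E
fromStepsFrom right cur (u ∷ us) = replicate (u ∸ cur) E ++ (N ∷ fromStepsFrom right u us)

fromSteps : ℕ → List ℕ → List Step
fromSteps right = fromStepsFrom right 0

-- everyFrom m c xs: the entries of xs at 0-based positions c, c+m, c+2m, ...  (m ≥ 1)
everyFrom : {A : Set} → ℕ → ℕ → List A → List A
everyFrom m c [] = []
everyFrom m zero (x ∷ xs) = x ∷ everyFrom m (m ∸ 1) xs
everyFrom m (suc c) (x ∷ xs) = everyFrom m c xs

-- σ ≤ σ' : σ' weakly above σ (Young diagram of σ' contained in that of σ),
-- i.e. the k-th north step of σ' is weakly left of the k-th north step of σ
_≤ᴾ_ : List Step → List Step → Set
σ ≤ᴾ σ' = Pointwise _≥_ (stepSeq σ) (stepSeq σ')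

≤ᴾ? : ∀ σ σ' → Dec (σ ≤ᴾ σ')
≤ᴾ? σ σ' = PW.decidable (λ x y → y ≤? x) (stepSeq σ) (stepSeq σ')

-- Dyck path decomposition (indices 0-based: i = 0..b-1 stands for i+1 ∈ [1,b])
-- p_i : path from (0,0) to (n, a n) with height sequence (h_{(k-1)b+i})_k
pComp : ℕ → ℕ → ℕ → List Step → ℕ → List Step
pComp a b n σ i = fromHeights (a * n) (everyFrom b i (heightSeq σ))

-- r_{i,j} : path from (0,0) to (n,n) with step sequence (u_{(k-1)a+j})_k of p_i
rComp : ℕ → ℕ → ℕ → List Step → ℕ → ℕ → List Step
rComp a b n σ i j = fromSteps n (everyFrom a j (stepSeq (pComp a b n σ i)))

DecompLeq : (a b n : ℕ) → List Step → List Step → Set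
DecompLeq a b n π π' = (i : Fin b) (j : Fin a) →
  rComp a b n π (toℕ i) (toℕ j) ≤ᴾ rComp a b n π' (toℕ i) (toℕ j)

decompLeq? : ∀ a b n π π' → Dec (DecompLeq a b n π π')
decompLeq? a b n π π' = FP.all? (λ i → FP.all? (λ j →
  ≤ᴾ? (rComp a b n π (toℕ i) (toℕ j)) (rComp a b n π' (toℕ i) (toℕ j))))

module Submission where

-- Both orders come down to comparisons of sorted sequences. For paths with the same endpoints,
-- π ≤ π' (step sequences pointwise ≥) is equivalent to the height sequences being pointwise ≤,
-- because both say that π has at most as many north steps as π' weakly left of every abscissa.
-- A pointwise comparison of lists holds iff it holds on every residue class of positions mod m,
-- and the class mod b of the heights of π is exactly the height sequence of p_i(π). So π ≤ π' iff
-- p_i(π) ≤ p_i(π') for every i, and repeating the argument with step sequences mod a, iff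
-- r_{i,j}(π) ≤ r_{i,j}(π') for all i, j. The two filtered lists therefore coincide.

open import Defs
open import Data.Nat using (ℕ; zero; suc; _+_; _*_; _∸_; _≤_; _≥_; _<_; _≰_; z≤n; s≤s; s≤s⁻¹; _<?_; _≤?_)
open import Data.Nat.Properties
open import Data.Nat.Coprimality using (Coprime)
open import Data.List using (List; []; _∷_; _++_; length; filter; replicate; map; tabulate)
open import Data.List.Properties
  using (filter-accept; filter-reject; filter-all; filter-none; map-++; map-replicate; tabulate-cong)
open import Data.List.Relation.Unary.All as All using (All; []; _∷_)
open import Data.List.Relation.Unary.All.Properties using (all-filter)
open import Data.List.Relation.Unary.AllPairs using (AllPairs; []; _∷_)
open import Data.List.Relation.Binary.Pointwise using (Pointwise; []; _∷_; tabulate⁺; tabulate⁻)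
open import Data.Product using (_,_)
open import Data.Fin using (Fin; toℕ; fromℕ<)
open import Data.Fin.Properties using (toℕ-fromℕ<)
open import Function using (_∘_; _⇔_; mk⇔; Equivalence)
open import Function.Properties.Equivalence using () renaming (refl to ⇔-refl; trans to ⇔-trans; sym to ⇔-sym)
open import Relation.Nullary using (Dec; yes; no; contradiction)
open import Relation.Binary.PropositionalEquality
  using (_≡_; refl; sym; trans; cong; cong₂; subst; subst₂; module ≡-Reasoning)

open Equivalence using (to; from)

Π-⇔ : {I : Set} {P Q : I → Set} → (∀ i → P i ⇔ Q i) → ((i : I) → P i) ⇔ ((i : I) → Q i)
Π-⇔ P⇔Q = mk⇔ (λ p i → to (P⇔Q i) (p i)) (λ q i → from (P⇔Q i) (q i))

≡⇒⇔ : {A B : Set} → A ≡ B → A ⇔ B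
≡⇒⇔ refl = ⇔-refl

filter-cong : {A : Set} {P Q : A → Set} (P? : ∀ x → Dec (P x)) (Q? : ∀ x → Dec (Q x)) →
  ∀ {xs} → All (λ x → P x ⇔ Q x) xs → filter P? xs ≡ filter Q? xs
filter-cong P? Q? [] = refl
filter-cong P? Q? {x ∷ xs} (P⇔Q ∷ rest) with P? x
... | yes px = trans (cong (x ∷_) (filter-cong P? Q? rest)) (sym (filter-accept Q? (to P⇔Q px)))
... | no ¬px = trans (filter-cong P? Q? rest) (sym (filter-reject Q? (¬px ∘ from P⇔Q)))

countAtMost : ℕ → List ℕ → ℕ
countAtMost t us = length (filter (_≤? t) us)

countAtMost-accept : ∀ {t u us} → u ≤ t → countAtMost t (u ∷ us) ≡ suc (countAtMost t us)
countAtMost-accept {t} u≤t = cong length (filter-accept (_≤? t) u≤t)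

countAtMost-reject : ∀ {t u us} → u ≰ t → countAtMost t (u ∷ us) ≡ countAtMost t us
countAtMost-reject {t} u≰t = cong length (filter-reject (_≤? t) u≰t)

countAtMost-none : ∀ {t us} → All (t <_) us → countAtMost t us ≡ 0
countAtMost-none {t} t<us = cong length (filter-none (_≤? t) (All.map <⇒≱ t<us))

countAtMost-all : ∀ {t us} → All (_≤ t) us → countAtMost t us ≡ length us
countAtMost-all {t} us≤t = cong length (filter-all (_≤? t) us≤t)

Pointwise-≥⇒countAtMost-≤ : ∀ {us us'} → Pointwise _≥_ us us' → ∀ t → countAtMost t us ≤ countAtMost t us'
Pointwise-≥⇒countAtMost-≤ [] t = z≤n
Pointwise-≥⇒countAtMost-≤ {u ∷ us} {u' ∷ us'} (u'≤u ∷ us≥us') t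
  with ih ← Pointwise-≥⇒countAtMost-≤ us≥us' t | u ≤? t | u' ≤? t
... | yes u≤t | yes u'≤t
  rewrite countAtMost-accept {us = us} u≤t | countAtMost-accept {us = us'} u'≤t = s≤s ih
... | yes u≤t | no u'≰t = contradiction (≤-trans u'≤u u≤t) u'≰t
... | no u≰t  | yes u'≤t
  rewrite countAtMost-reject {us = us} u≰t | countAtMost-accept {us = us'} u'≤t = m≤n⇒m≤1+n ih
... | no u≰t  | no u'≰t
  rewrite countAtMost-reject {us = us} u≰t | countAtMost-reject {us = us'} u'≰t = ih

countAtMost-≤⇒Pointwise-≥ : ∀ {us us'} → AllPairs _≤_ us → AllPairs _≤_ us' → length us ≡ length us' →
  (∀ t → countAtMost t us ≤ countAtMost t us') → Pointwise _≥_ us us'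
countAtMost-≤⇒Pointwise-≥ {[]} {[]} _ _ _ _ = []
countAtMost-≤⇒Pointwise-≥ {u ∷ us} {u' ∷ us'} (u≤us ∷ sorted) (u'≤us' ∷ sorted') eq count≤ =
  u'≤u ∷ countAtMost-≤⇒Pointwise-≥ sorted sorted' (suc-injective eq) count≤-tail
  where
  u'≤u : u' ≤ u
  u'≤u = ≮⇒≥ λ u<u' → contradiction
    (subst₂ _≤_ (countAtMost-accept {us = us} (≤-refl {u}))
                (countAtMost-none (u<u' ∷ All.map (<-≤-trans u<u') u'≤us'))
                (count≤ u))
    λ ()

  count≤-tail : ∀ t → countAtMost t us ≤ countAtMost t us'
  count≤-tail t with u ≤? t
  ... | yes u≤t =
    s≤s⁻¹ (subst₂ _≤_ (countAtMost-accept u≤t) (countAtMost-accept (≤-trans u'≤u u≤t)) (count≤ t))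
  ... | no u≰t = ≤-trans (≤-reflexive (countAtMost-none (All.map (<-≤-trans (≰⇒> u≰t)) u≤us))) z≤n

countAtMost-≤-beyondBound : ∀ e {us us'} → All (_≤ e) us → All (_≤ e) us' → length us ≡ length us' →
  (∀ (k : Fin e) → countAtMost (toℕ k) us ≤ countAtMost (toℕ k) us') →
  ∀ t → countAtMost t us ≤ countAtMost t us'
countAtMost-≤-beyondBound e {us} {us'} us≤e us'≤e eq count≤ t with t <? e
... | yes t<e = subst (λ s → countAtMost s us ≤ countAtMost s us') (toℕ-fromℕ< t<e) (count≤ (fromℕ< t<e))
... | no t≮e = ≤-reflexive (begin
  countAtMost t us   ≡⟨ countAtMost-all (All.map (λ u≤e → ≤-trans u≤e (≮⇒≥ t≮e)) us≤e) ⟩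
  length us          ≡⟨ eq ⟩
  length us'         ≡⟨ sym (countAtMost-all (All.map (λ u≤e → ≤-trans u≤e (≮⇒≥ t≮e)) us'≤e)) ⟩
  countAtMost t us'  ∎)
  where open ≡-Reasoning

Pointwise-≥⇔countAtMost-≤ : ∀ e {us us'} → AllPairs _≤_ us → AllPairs _≤_ us' →
  All (_≤ e) us → All (_≤ e) us' → length us ≡ length us' →
  Pointwise _≥_ us us' ⇔ (∀ (k : Fin e) → countAtMost (toℕ k) us ≤ countAtMost (toℕ k) us')
Pointwise-≥⇔countAtMost-≤ e sorted sorted' us≤e us'≤e eq = mk⇔
  (λ us≥us' k → Pointwise-≥⇒countAtMost-≤ us≥us' (toℕ k))
  (λ count≤ → countAtMost-≤⇒Pointwise-≥ sorted sorted' eq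
                 (countAtMost-≤-beyondBound e us≤e us'≤e eq count≤))

stepSeqFrom-length : ∀ x σ → length (stepSeqFrom x σ) ≡ #N σ
stepSeqFrom-length x [] = refl
stepSeqFrom-length x (N ∷ σ) = cong suc (stepSeqFrom-length x σ)
stepSeqFrom-length x (E ∷ σ) = stepSeqFrom-length (suc x) σ

stepSeqFrom-≥ : ∀ x σ → All (x ≤_) (stepSeqFrom x σ)
stepSeqFrom-≥ x [] = []
stepSeqFrom-≥ x (N ∷ σ) = ≤-refl ∷ stepSeqFrom-≥ x σ
stepSeqFrom-≥ x (E ∷ σ) = All.map (≤-trans (n≤1+n x)) (stepSeqFrom-≥ (suc x) σ)

stepSeqFrom-≤ : ∀ x σ → All (_≤ x + #E σ) (stepSeqFrom x σ)
stepSeqFrom-≤ x [] = []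
stepSeqFrom-≤ x (N ∷ σ) = m≤m+n x (#E σ) ∷ stepSeqFrom-≤ x σ
stepSeqFrom-≤ x (E ∷ σ) rewrite +-suc x (#E σ) = stepSeqFrom-≤ (suc x) σ

stepSeqFrom-sorted : ∀ x σ → AllPairs _≤_ (stepSeqFrom x σ)
stepSeqFrom-sorted x [] = []
stepSeqFrom-sorted x (N ∷ σ) = stepSeqFrom-≥ x σ ∷ stepSeqFrom-sorted x σ
stepSeqFrom-sorted x (E ∷ σ) = stepSeqFrom-sorted (suc x) σ

-- The k-th east step starts at abscissa x + k, so its height counts the north steps weakly left of it.
heightSeqFrom-countAtMost : ∀ x y σ →
  heightSeqFrom y σ ≡ tabulate (λ (k : Fin (#E σ)) → y + countAtMost (x + toℕ k) (stepSeqFrom x σ))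
heightSeqFrom-countAtMost x y [] = refl
heightSeqFrom-countAtMost x y (N ∷ σ) =
  trans (heightSeqFrom-countAtMost x (suc y) σ) (tabulate-cong λ k → sym (begin
    y + countAtMost (x + toℕ k) (x ∷ stepSeqFrom x σ)  ≡⟨ cong (y +_) (countAtMost-accept (m≤m+n x (toℕ k))) ⟩
    y + suc (countAtMost (x + toℕ k) (stepSeqFrom x σ)) ≡⟨ +-suc y _ ⟩
    suc y + countAtMost (x + toℕ k) (stepSeqFrom x σ)  ∎))
  where open ≡-Reasoning
heightSeqFrom-countAtMost x y (E ∷ σ) = cong₂ _∷_ head
  (trans (heightSeqFrom-countAtMost (suc x) y σ) (tabulate-cong λ k →
    cong (λ s → y + countAtMost s (stepSeqFrom (suc x) σ)) (sym (+-suc x (toℕ k)))))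
  where
  head : y ≡ y + countAtMost (x + 0) (stepSeqFrom (suc x) σ)
  head rewrite +-identityʳ x | countAtMost-none (stepSeqFrom-≥ (suc x) σ) = sym (+-identityʳ y)

heightSeq-tabulate : ∀ {e} σ → #E σ ≡ e →
  heightSeq σ ≡ tabulate (λ (k : Fin e) → countAtMost (toℕ k) (stepSeq σ))
heightSeq-tabulate σ refl = heightSeqFrom-countAtMost 0 0 σ

stepSeq-≥⇔heightSeq-≤ : ∀ σ σ' → #N σ ≡ #N σ' → #E σ ≡ #E σ' →
  Pointwise _≥_ (stepSeq σ) (stepSeq σ') ⇔ Pointwise _≤_ (heightSeq σ) (heightSeq σ')
stepSeq-≥⇔heightSeq-≤ σ σ' eqN eqE rewrite heightSeq-tabulate σ refl | heightSeq-tabulate σ' (sym eqE) =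
  ⇔-trans
    (Pointwise-≥⇔countAtMost-≤ (#E σ) (stepSeqFrom-sorted 0 σ) (stepSeqFrom-sorted 0 σ')
      (stepSeqFrom-≤ 0 σ) (subst (λ e → All (_≤ e) (stepSeq σ')) (sym eqE) (stepSeqFrom-≤ 0 σ'))
      (trans (stepSeqFrom-length 0 σ) (trans eqN (sym (stepSeqFrom-length 0 σ')))))
    (mk⇔ tabulate⁺ tabulate⁻)

#N-++ : ∀ σ τ → #N (σ ++ τ) ≡ #N σ + #N τ
#N-++ [] τ = refl
#N-++ (N ∷ σ) τ = cong suc (#N-++ σ τ)
#N-++ (E ∷ σ) τ = #N-++ σ τ

#E-++ : ∀ σ τ → #E (σ ++ τ) ≡ #E σ + #E τ
#E-++ [] τ = refl
#E-++ (N ∷ σ) τ = #E-++ σ τ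
#E-++ (E ∷ σ) τ = cong suc (#E-++ σ τ)

stepSeqFrom-++ : ∀ x σ τ → stepSeqFrom x (σ ++ τ) ≡ stepSeqFrom x σ ++ stepSeqFrom (#E σ + x) τ
stepSeqFrom-++ x [] τ = refl
stepSeqFrom-++ x (N ∷ σ) τ = cong (x ∷_) (stepSeqFrom-++ x σ τ)
stepSeqFrom-++ x (E ∷ σ) τ rewrite stepSeqFrom-++ (suc x) σ τ | +-suc (#E σ) x = refl

#N-replicate-E : ∀ k → #N (replicate k E) ≡ 0
#N-replicate-E zero = refl
#N-replicate-E (suc k) = #N-replicate-E k

#E-replicate-E : ∀ k → #E (replicate k E) ≡ k
#E-replicate-E zero = refl
#E-replicate-E (suc k) = cong suc (#E-replicate-E k)

stepSeqFrom-replicate-E : ∀ x k → stepSeqFrom x (replicate k E) ≡ []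
stepSeqFrom-replicate-E x zero = refl
stepSeqFrom-replicate-E x (suc k) = stepSeqFrom-replicate-E (suc x) k

stepSeqFrom-fromStepsFrom : ∀ right cur us → All (cur ≤_) us → AllPairs _≤_ us →
  stepSeqFrom cur (fromStepsFrom right cur us) ≡ us
stepSeqFrom-fromStepsFrom right cur [] _ _ = stepSeqFrom-replicate-E cur (right ∸ cur)
stepSeqFrom-fromStepsFrom right cur (u ∷ us) (cur≤u ∷ _) (u≤us ∷ sorted)
  rewrite stepSeqFrom-++ cur (replicate (u ∸ cur) E) (N ∷ fromStepsFrom right u us)
        | stepSeqFrom-replicate-E cur (u ∸ cur) | #E-replicate-E (u ∸ cur) | m∸n+n≡m cur≤u
  = cong (u ∷_) (stepSeqFrom-fromStepsFrom right u us u≤us sorted)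

#N-fromStepsFrom : ∀ right cur us → #N (fromStepsFrom right cur us) ≡ length us
#N-fromStepsFrom right cur [] = #N-replicate-E (right ∸ cur)
#N-fromStepsFrom right cur (u ∷ us)
  rewrite #N-++ (replicate (u ∸ cur) E) (N ∷ fromStepsFrom right u us) | #N-replicate-E (u ∸ cur)
  = cong suc (#N-fromStepsFrom right u us)

#E-fromStepsFrom : ∀ right cur us → All (cur ≤_) us → AllPairs _≤_ us → All (_≤ right) us →
  #E (fromStepsFrom right cur us) ≡ right ∸ cur
#E-fromStepsFrom right cur [] _ _ _ = #E-replicate-E (right ∸ cur)
#E-fromStepsFrom right cur (u ∷ us) (cur≤u ∷ _) (u≤us ∷ sorted) (u≤right ∷ us≤right)
  rewrite #E-++ (replicate (u ∸ cur) E) (N ∷ fromStepsFrom right u us) | #E-replicate-E (u ∸ cur)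
        | #E-fromStepsFrom right u us u≤us sorted us≤right
  = begin
    (u ∸ cur) + (right ∸ u)  ≡⟨ +-comm (u ∸ cur) (right ∸ u) ⟩
    (right ∸ u) + (u ∸ cur)  ≡⟨ sym (+-∸-assoc (right ∸ u) cur≤u) ⟩
    (right ∸ u + u) ∸ cur    ≡⟨ cong (_∸ cur) (m∸n+n≡m u≤right) ⟩
    right ∸ cur              ∎
  where open ≡-Reasoning

transposeStep : Step → Step
transposeStep N = E
transposeStep E = N

transpose : List Step → List Step
transpose = map transposeStep

#N-transpose : ∀ σ → #N (transpose σ) ≡ #E σ
#N-transpose [] = refl
#N-transpose (N ∷ σ) = #N-transpose σ
#N-transpose (E ∷ σ) = cong suc (#N-transpose σ)

#E-transpose : ∀ σ → #E (transpose σ) ≡ #N σ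
#E-transpose [] = refl
#E-transpose (N ∷ σ) = cong suc (#E-transpose σ)
#E-transpose (E ∷ σ) = #E-transpose σ

stepSeqFrom-transpose : ∀ x σ → stepSeqFrom x (transpose σ) ≡ heightSeqFrom x σ
stepSeqFrom-transpose x [] = refl
stepSeqFrom-transpose x (N ∷ σ) = stepSeqFrom-transpose (suc x) σ
stepSeqFrom-transpose x (E ∷ σ) = cong (x ∷_) (stepSeqFrom-transpose x σ)

heightSeqFrom-transpose : ∀ y σ → heightSeqFrom y (transpose σ) ≡ stepSeqFrom y σ
heightSeqFrom-transpose y [] = refl
heightSeqFrom-transpose y (N ∷ σ) = cong (y ∷_) (heightSeqFrom-transpose y σ)
heightSeqFrom-transpose y (E ∷ σ) = heightSeqFrom-transpose (suc y) σ

fromHeightsFrom-transpose : ∀ top cur hs →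
  fromHeightsFrom top cur hs ≡ transpose (fromStepsFrom top cur hs)
fromHeightsFrom-transpose top cur [] = sym (map-replicate transposeStep (top ∸ cur) E)
fromHeightsFrom-transpose top cur (h ∷ hs) = sym (begin
  transpose (replicate (h ∸ cur) E ++ N ∷ fromStepsFrom top h hs)
    ≡⟨ map-++ transposeStep (replicate (h ∸ cur) E) (N ∷ fromStepsFrom top h hs) ⟩
  transpose (replicate (h ∸ cur) E) ++ E ∷ transpose (fromStepsFrom top h hs)
    ≡⟨ cong₂ (λ ns rest → ns ++ E ∷ rest) (map-replicate transposeStep (h ∸ cur) E)
                                           (sym (fromHeightsFrom-transpose top h hs)) ⟩
  replicate (h ∸ cur) N ++ E ∷ fromHeightsFrom top h hs
    ∎)
  where open ≡-Reasoning

heightSeqFrom-length : ∀ y σ → length (heightSeqFrom y σ) ≡ #E σ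
heightSeqFrom-length y σ = begin
  length (heightSeqFrom y σ)           ≡⟨ cong length (sym (stepSeqFrom-transpose y σ)) ⟩
  length (stepSeqFrom y (transpose σ)) ≡⟨ stepSeqFrom-length y (transpose σ) ⟩
  #N (transpose σ)                     ≡⟨ #N-transpose σ ⟩
  #E σ                                 ∎
  where open ≡-Reasoning

heightSeqFrom-≤ : ∀ y σ → All (_≤ y + #N σ) (heightSeqFrom y σ)
heightSeqFrom-≤ y σ =
  subst₂ (λ top hs → All (_≤ top) hs) (cong (y +_) (#E-transpose σ)) (stepSeqFrom-transpose y σ)
    (stepSeqFrom-≤ y (transpose σ))

heightSeqFrom-sorted : ∀ y σ → AllPairs _≤_ (heightSeqFrom y σ)
heightSeqFrom-sorted y σ =
  subst (AllPairs _≤_) (stepSeqFrom-transpose y σ) (stepSeqFrom-sorted y (transpose σ))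

heightSeq-fromHeights : ∀ top hs → AllPairs _≤_ hs → heightSeq (fromHeights top hs) ≡ hs
heightSeq-fromHeights top hs sorted
  rewrite fromHeightsFrom-transpose top 0 hs | heightSeqFrom-transpose 0 (fromStepsFrom top 0 hs)
  = stepSeqFrom-fromStepsFrom top 0 hs (All.universal (λ _ → z≤n) hs) sorted

#E-fromHeights : ∀ top hs → #E (fromHeights top hs) ≡ length hs
#E-fromHeights top hs rewrite fromHeightsFrom-transpose top 0 hs =
  trans (#E-transpose (fromStepsFrom top 0 hs)) (#N-fromStepsFrom top 0 hs)

#N-fromHeights : ∀ top hs → AllPairs _≤_ hs → All (_≤ top) hs → #N (fromHeights top hs) ≡ top
#N-fromHeights top hs sorted hs≤top rewrite fromHeightsFrom-transpose top 0 hs =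
  trans (#N-transpose (fromStepsFrom top 0 hs))
        (#E-fromStepsFrom top 0 hs (All.universal (λ _ → z≤n) hs) sorted hs≤top)

module _ {A : Set} where

  All-everyFrom : ∀ {P : A → Set} m c {xs} → All P xs → All P (everyFrom m c xs)
  All-everyFrom m c [] = []
  All-everyFrom m zero (px ∷ pxs) = px ∷ All-everyFrom m (m ∸ 1) pxs
  All-everyFrom m (suc c) (px ∷ pxs) = All-everyFrom m c pxs

  AllPairs-everyFrom : ∀ {R : A → A → Set} m c {xs} → AllPairs R xs → AllPairs R (everyFrom m c xs)
  AllPairs-everyFrom m c [] = []
  AllPairs-everyFrom m zero (Rx ∷ Rxs) = All-everyFrom m (m ∸ 1) Rx ∷ AllPairs-everyFrom m (m ∸ 1) Rxs
  AllPairs-everyFrom m (suc c) (Rx ∷ Rxs) = AllPairs-everyFrom m c Rxs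

  length-everyFrom : ∀ {B : Set} m c (xs : List A) (ys : List B) → length xs ≡ length ys →
    length (everyFrom m c xs) ≡ length (everyFrom m c ys)
  length-everyFrom m c [] [] _ = refl
  length-everyFrom m zero (_ ∷ xs) (_ ∷ ys) eq =
    cong suc (length-everyFrom m (m ∸ 1) xs ys (suc-injective eq))
  length-everyFrom m (suc c) (_ ∷ xs) (_ ∷ ys) eq = length-everyFrom m c xs ys (suc-injective eq)

module _ {A B : Set} {R : A → B → Set} where

  Pointwise-everyFrom⁺ : ∀ m c {xs ys} → Pointwise R xs ys →
    Pointwise R (everyFrom m c xs) (everyFrom m c ys)
  Pointwise-everyFrom⁺ m c [] = []
  Pointwise-everyFrom⁺ m zero (x∼y ∷ xs∼ys) = x∼y ∷ Pointwise-everyFrom⁺ m (m ∸ 1) xs∼ys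
  Pointwise-everyFrom⁺ m (suc c) (x∼y ∷ xs∼ys) = Pointwise-everyFrom⁺ m c xs∼ys

  -- Class m-1 of the tail is the rest of class 0; its class c < m-1 is class c+1 of the whole list.
  Pointwise-everyFrom⁻ : ∀ m → 1 ≤ m → ∀ {xs ys} →
    (∀ c → c < m → Pointwise R (everyFrom m c xs) (everyFrom m c ys)) → Pointwise R xs ys
  Pointwise-everyFrom⁻ m _ {[]} {[]} _ = []
  Pointwise-everyFrom⁻ m 1≤m {[]} {_ ∷ _} classes with () ← classes 0 1≤m
  Pointwise-everyFrom⁻ m 1≤m {_ ∷ _} {[]} classes with () ← classes 0 1≤m
  Pointwise-everyFrom⁻ (suc m) 1≤m {_ ∷ xs} {_ ∷ ys} classes with x∼y ∷ rest₀ ← classes 0 1≤m =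
    x∼y ∷ Pointwise-everyFrom⁻ (suc m) 1≤m tailClasses
    where
    tailClasses : ∀ c → c < suc m → Pointwise R (everyFrom (suc m) c xs) (everyFrom (suc m) c ys)
    tailClasses c c<1+m with suc c <? suc m
    ... | yes 1+c<1+m = classes (suc c) 1+c<1+m
    ... | no 1+c≮1+m = subst (λ c → Pointwise R (everyFrom (suc m) c xs) (everyFrom (suc m) c ys))
                         (≤-antisym (s≤s⁻¹ (≮⇒≥ 1+c≮1+m)) (s≤s⁻¹ c<1+m)) rest₀

  Pointwise⇔Pointwise-everyFrom : ∀ m → 1 ≤ m → ∀ {xs ys} →
    Pointwise R xs ys ⇔ (∀ (c : Fin m) → Pointwise R (everyFrom m (toℕ c) xs) (everyFrom m (toℕ c) ys))
  Pointwise⇔Pointwise-everyFrom m 1≤m {xs} {ys} = mk⇔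
    (λ xs∼ys c → Pointwise-everyFrom⁺ m (toℕ c) xs∼ys)
    (λ classes → Pointwise-everyFrom⁻ m 1≤m λ c c<m →
      subst (λ c → Pointwise R (everyFrom m c xs) (everyFrom m c ys)) (toℕ-fromℕ< c<m)
        (classes (fromℕ< c<m)))

heightClass : ℕ → ℕ → List Step → List ℕ
heightClass b i σ = everyFrom b i (heightSeq σ)

heightClass-sorted : ∀ b i σ → AllPairs _≤_ (heightClass b i σ)
heightClass-sorted b i σ = AllPairs-everyFrom b i (heightSeqFrom-sorted 0 σ)

module _ (a b n : ℕ) where

  heightSeq-pComp : ∀ σ i → heightSeq (pComp a b n σ i) ≡ heightClass b i σ
  heightSeq-pComp σ i = heightSeq-fromHeights (a * n) (heightClass b i σ) (heightClass-sorted b i σ)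

  #E-pComp : ∀ σ i → #E (pComp a b n σ i) ≡ length (heightClass b i σ)
  #E-pComp σ i = #E-fromHeights (a * n) (heightClass b i σ)

  #N-pComp : ∀ σ i → #N σ ≤ a * n → #N (pComp a b n σ i) ≡ a * n
  #N-pComp σ i #N≤an = #N-fromHeights (a * n) (heightClass b i σ) (heightClass-sorted b i σ)
    (All-everyFrom b i (All.map (λ h≤#N → ≤-trans h≤#N #N≤an) (heightSeqFrom-≤ 0 σ)))

  stepSeq-rComp : ∀ σ i j → stepSeq (rComp a b n σ i j) ≡ everyFrom a j (stepSeq (pComp a b n σ i))
  stepSeq-rComp σ i j = stepSeqFrom-fromStepsFrom n 0 classⱼ (All.universal (λ _ → z≤n) classⱼ)
    (AllPairs-everyFrom a j (stepSeqFrom-sorted 0 (pComp a b n σ i)))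
    where
    classⱼ : List ℕ
    classⱼ = everyFrom a j (stepSeq (pComp a b n σ i))

  rComp-≤ᴾ⇔heightClass-≤ : 1 ≤ a → ∀ {π π'} → #N π ≤ a * n → #N π' ≤ a * n → #E π ≡ #E π' → ∀ i →
    (∀ (j : Fin a) → rComp a b n π i (toℕ j) ≤ᴾ rComp a b n π' i (toℕ j))
      ⇔ Pointwise _≤_ (heightClass b i π) (heightClass b i π')
  rComp-≤ᴾ⇔heightClass-≤ 1≤a {π} {π'} #N≤an #N'≤an eqE i =
    ⇔-trans (Π-⇔ λ j →
      ≡⇒⇔ (cong₂ (Pointwise _≥_) (stepSeq-rComp π i (toℕ j)) (stepSeq-rComp π' i (toℕ j))))
    (⇔-trans (⇔-sym (Pointwise⇔Pointwise-everyFrom a 1≤a))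
    (⇔-trans (stepSeq-≥⇔heightSeq-≤ (pComp a b n π i) (pComp a b n π' i) #N-equal #E-equal)
             (≡⇒⇔ (cong₂ (Pointwise _≤_) (heightSeq-pComp π i) (heightSeq-pComp π' i)))))
    where
    #N-equal : #N (pComp a b n π i) ≡ #N (pComp a b n π' i)
    #N-equal = trans (#N-pComp π i #N≤an) (sym (#N-pComp π' i #N'≤an))

    #E-equal : #E (pComp a b n π i) ≡ #E (pComp a b n π' i)
    #E-equal = trans (#E-pComp π i)
      (trans (length-everyFrom b i (heightSeq π) (heightSeq π') lengths) (sym (#E-pComp π' i)))
      where
      lengths : length (heightSeq π) ≡ length (heightSeq π')
      lengths = trans (heightSeqFrom-length 0 π) (trans eqE (sym (heightSeqFrom-length 0 π')))

decompLeq⇔≤ᴾ : ∀ {a b n π π'} → 1 ≤ a → 1 ≤ b → IsDyck a b n π → IsDyck a b n π' →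
  DecompLeq a b n π π' ⇔ π ≤ᴾ π'
decompLeq⇔≤ᴾ {a} {b} {n} {π} {π'} 1≤a 1≤b (#Eπ , #Nπ , _) (#Eπ' , #Nπ' , _) =
  ⇔-trans (Π-⇔ λ i →
    rComp-≤ᴾ⇔heightClass-≤ a b n 1≤a {π} {π'} (≤-reflexive #Nπ) (≤-reflexive #Nπ') #E-equal (toℕ i))
  (⇔-trans (⇔-sym (Pointwise⇔Pointwise-everyFrom b 1≤b))
           (⇔-sym (stepSeq-≥⇔heightSeq-≤ π π' (trans #Nπ (sym #Nπ')) #E-equal)))
  where
  #E-equal : #E π ≡ #E π'
  #E-equal = trans #Eπ (sym #Eπ')

mainTheorem9 : (a b n : ℕ) → a ≥ 1 → b ≥ 1 → Coprime a b → n ≥ 1 →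
    (π : List Step) → IsDyck a b n π →
    length (filter (decompLeq? a b n π) (dyckPaths a b n))
      ≡ length (filter (≤ᴾ? π) (dyckPaths a b n))
mainTheorem9 a b n 1≤a 1≤b _ _ π dπ = cong length (filter-cong (decompLeq? a b n π) (≤ᴾ? π)
  (All.map (decompLeq⇔≤ᴾ 1≤a 1≤b dπ) (all-filter (isDyck? a b n) (words (b * n) (a * n)))))
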